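{- Let $G$ be an $(n-4)$-regular graph on $n$ vertices (so its complement $\bar G$ is cubic). If $G$ has an internal partition, then either $\bar G$ has an external bisection, or $\bar G$ has an independent set of size at least $n/2-1$.
   Context: Graphs are finite and simple; $\bar G$ is the complement of $G$. For $S\subseteq V$, $d_S(v)$ is the number of neighbors of $v$ in $S$ and $d(v)$ the degree (in the graph under consideration). A partition $(A,B)$ of $V$ with $A,B\ne\emptyset$ is internal if $d_A(x)\ge d(x)/2$ for all $x\in A$ and $d_B(x)\ge d(x)/2$ for all $x\in B$; it is external if $d_B(x)\ge d(x)/2$ for all $x\in A$ and $d_A(x)\ge d(x)/2$ for all $x\in B$. An external bisection is an external partition with $|A|=|B|$. -}

module Defs where

open import Data.Nat using (ℕ; _+_; _*_; _≥_)
open import Data.Bool using (Bool; true; false; not; _∧_; T)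
open import Data.Fin using (Fin)
open import Data.Fin.Properties using (_≟_)
open import Data.List using (List; filter; length; allFin)
open import Data.Product using (_×_; ∃)
open import Relation.Nullary using (¬_; does)
open import Relation.Binary.PropositionalEquality using (_≡_)

record Graph (n : ℕ) : Set where
  field
    adj   : Fin n → Fin n → Bool
    sym   : ∀ x y → adj x y ≡ adj y x
    irrefl : ∀ x → adj x x ≡ false
open Graph public

count : {n : ℕ} → (Fin n → Bool) → ℕ
count {n} p = length (filter (λ x → T? (p x)) (allFin n))
  where
  open import Data.Bool.Properties using (T?)

complement : {n : ℕ} → Graph n → Graph n
complement {n} G = record
  { adj = λ x y → not (does (x ≟ y)) ∧ not (adj G x y)
  ; sym = symC
  ; irrefl = irC }
  where
  open import Relation.Binary.PropositionalEquality using (refl; cong₂; cong)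
  open import Relation.Nullary using (yes; no)
  ddiag : ∀ (x y : Fin n) → does (x ≟ y) ≡ does (y ≟ x)
  ddiag x y with x ≟ y | y ≟ x
  ... | yes _ | yes _ = refl
  ... | no _ | no _ = refl
  ... | yes refl | no q = Data.Empty.⊥-elim (q refl) where import Data.Empty
  ... | no q | yes refl = Data.Empty.⊥-elim (q refl) where import Data.Empty
  symC : ∀ x y → (not (does (x ≟ y)) ∧ not (adj G x y)) ≡ (not (does (y ≟ x)) ∧ not (adj G y x))
  symC x y = cong₂ (λ a b → not a ∧ not b) (ddiag x y) (Graph.sym G x y)
  irC : ∀ x → (not (does (x ≟ x)) ∧ not (adj G x x)) ≡ false
  irC x with x ≟ x
  ... | yes _ = refl
  ... | no q = Data.Empty.⊥-elim (q refl) where import Data.Empty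

deg : {n : ℕ} → Graph n → Fin n → ℕ
deg G v = count (adj G v)

degIn : {n : ℕ} → Graph n → (Fin n → Bool) → Fin n → ℕ
degIn G S v = count (λ u → S u ∧ adj G v u)

Regular : {n : ℕ} → Graph n → ℕ → Set
Regular G k = ∀ v → deg G v ≡ k

-- A partition (A, B) of V is given by A : Fin n → Bool, with B its complement.
-- Both parts nonempty.
NonTrivial : {n : ℕ} → (Fin n → Bool) → Set
NonTrivial {n} A = ∃ (λ (x : Fin n) → A x ≡ true) × ∃ (λ (x : Fin n) → A x ≡ false)

-- d_A(x) ≥ d(x)/2 written as 2·d_A(x) ≥ d(x)
IsInternal : {n : ℕ} → Graph n → (Fin n → Bool) → Set
IsInternal {n} G A = NonTrivial A ×
  (∀ (x : Fin n) → A x ≡ true  → 2 * degIn G A x ≥ deg G x) ×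
  (∀ (x : Fin n) → A x ≡ false → 2 * degIn G (λ u → not (A u)) x ≥ deg G x)

IsExternal : {n : ℕ} → Graph n → (Fin n → Bool) → Set
IsExternal {n} G A = NonTrivial A ×
  (∀ (x : Fin n) → A x ≡ true  → 2 * degIn G (λ u → not (A u)) x ≥ deg G x) ×
  (∀ (x : Fin n) → A x ≡ false → 2 * degIn G A x ≥ deg G x)

HasInternalPartition : {n : ℕ} → Graph n → Set
HasInternalPartition {n} G = ∃ (λ (A : Fin n → Bool) → IsInternal G A)

HasExternalBisection : {n : ℕ} → Graph n → Set
HasExternalBisection {n} G = ∃ (λ (A : Fin n → Bool) →
  IsExternal G A × count A ≡ count (λ u → not (A u)))

IsIndependent : {n : ℕ} → Graph n → (Fin n → Bool) → Set
IsIndependent {n} G S = ∀ (x y : Fin n) → S x ≡ true → S y ≡ true → adj G x y ≡ false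

-- Everything follows from one local identity:
-- for a vertex x of a vertex set S, the vertices of S are x itself, its
-- G-neighbours in S and its Ḡ-neighbours in S, so
--     d^G_S(x) + d^Ḡ_S(x) + 1 = |S|      and     d_G(x) + d_Ḡ(x) + 1 = n.
-- Compare |A| with |B|.
--  * |A| = |B| = n/2.  For x ∈ A, internality 2·d^G_A(x) ≥ d_G(x) and the two
--    identities give d^Ḡ_A(x) ≤ d^Ḡ_B(x), i.e. x has at least half of its
--    Ḡ-neighbours in B; symmetrically for B.  So (A, B) is an external
--    bisection of Ḡ.  This step works for every graph, regular or not.
--  * |A| < |B|, so 2|A| ≤ n - 1.  For x ∈ A, regularity gives
--    n - 4 ≤ 2·d^G_A(x), and the first identity forces d^Ḡ_A(x) = 0 and
--    n ≤ 2|A| + 2: A is independent in Ḡ and large enough.  |A| > |B| is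
--    symmetric.
module Submission where

open import Defs hiding (sym)
open import Data.Nat using (ℕ; suc; _+_; _*_; _∸_; _≤_; _<_; _≥_; _>_; z≤n; s≤s)
open import Data.Nat.Properties
  using (≤-trans; ≤-reflexive; +-monoˡ-≤; +-monoʳ-≤; +-monoʳ-<; +-cancelˡ-≤;
         m≤n+m; m≤m+n; m+n≤o⇒m≤o; *-monoʳ-≤; m≤n+m∸n; +-comm; *-cancelˡ-<; n<1⇒n≡0; <-cmp; module ≤-Reasoning)
open import Data.Nat.Tactic.RingSolver using (solve-∀)
open import Data.Bool using (Bool; true; false; not; _∧_)
open import Data.Bool.Properties using (T?; not-involutive; not-injective; ∧-identityʳ)
open import Data.Fin using (Fin)
open import Data.Fin.Properties using (_≟_)
open import Data.List using (List; []; _∷_; filter; length; allFin)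
open import Data.List.Membership.Propositional using (_∈_)
open import Data.List.Membership.Propositional.Properties using (∈-allFin)
open import Data.List.Properties using (length-tabulate)
open import Data.List.Relation.Unary.Any using (here; there)
open import Data.Product using (_×_; ∃; _,_; proj₁; proj₂)
open import Data.Sum using (_⊎_; inj₁; inj₂)
open import Data.Empty using (⊥-elim)
open import Relation.Nullary using (does; yes; no)
open import Relation.Binary using (Tri; tri<; tri≈; tri>)
open import Relation.Binary.PropositionalEquality
  using (_≡_; refl; sym; trans; cong; cong₂; subst; module ≡-Reasoning)

ind : Bool → ℕ
ind true  = 1
ind false = 0

countIn : {X : Set} → (X → Bool) → List X → ℕ
countIn p xs = length (filter (λ x → T? (p x)) xs)

countIn-∷ : {X : Set} (p : X → Bool) (y : X) (ys : List X) →
  countIn p (y ∷ ys) ≡ ind (p y) + countIn p ys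
countIn-∷ p y ys with p y
... | true  = refl
... | false = refl

countIn-additive : {X : Set} (p q r : X → Bool) → (∀ u → ind (p u) + ind (q u) ≡ ind (r u)) →
  ∀ xs → countIn p xs + countIn q xs ≡ countIn r xs
countIn-additive p q r split [] = refl
countIn-additive p q r split (y ∷ ys) = begin
    countIn p (y ∷ ys) + countIn q (y ∷ ys)
      ≡⟨ cong₂ _+_ (countIn-∷ p y ys) (countIn-∷ q y ys) ⟩
    ind (p y) + countIn p ys + (ind (q y) + countIn q ys)
      ≡⟨ interchange (ind (p y)) (ind (q y)) (countIn p ys) (countIn q ys) ⟩
    ind (p y) + ind (q y) + (countIn p ys + countIn q ys)
      ≡⟨ cong₂ _+_ (split y) (countIn-additive p q r split ys) ⟩
    ind (r y) + countIn r ys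
      ≡⟨ countIn-∷ r y ys ⟨
    countIn r (y ∷ ys) ∎
  where
  open ≡-Reasoning
  interchange : ∀ a b x z → a + x + (b + z) ≡ a + b + (x + z)
  interchange = solve-∀

countIn-cong : {X : Set} (p q : X → Bool) → (∀ u → p u ≡ q u) →
  ∀ xs → countIn p xs ≡ countIn q xs
countIn-cong p q eq [] = refl
countIn-cong p q eq (y ∷ ys)
  rewrite countIn-∷ p y ys | countIn-∷ q y ys | eq y | countIn-cong p q eq ys = refl

countIn-pos : {X : Set} (p : X → Bool) {y : X} (xs : List X) → y ∈ xs → p y ≡ true →
  1 ≤ countIn p xs
countIn-pos p (y ∷ ys) (here refl) py rewrite countIn-∷ p y ys | py = s≤s z≤n
countIn-pos p (z ∷ ys) (there y∈ys) py rewrite countIn-∷ p z ys =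
  ≤-trans (countIn-pos p ys y∈ys py) (m≤n+m (countIn p ys) (ind (p z)))

countIn-true : {X : Set} (xs : List X) → countIn (λ _ → true) xs ≡ length xs
countIn-true []       = refl
countIn-true (_ ∷ ys) = cong suc (countIn-true ys)

count-cong : {n : ℕ} (p q : Fin n → Bool) → (∀ u → p u ≡ q u) → count p ≡ count q
count-cong {n} p q eq = countIn-cong p q eq (allFin n)

count-additive : {n : ℕ} (p q r : Fin n → Bool) → (∀ u → ind (p u) + ind (q u) ≡ ind (r u)) →
  count p + count q ≡ count r
count-additive {n} p q r split = countIn-additive p q r split (allFin n)

count-all : (n : ℕ) → count {n} (λ _ → true) ≡ n
count-all n = trans (countIn-true (allFin n)) (length-tabulate (λ i → i))

count-pos : {n : ℕ} (p : Fin n → Bool) (y : Fin n) → p y ≡ true → 1 ≤ count p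
count-pos {n} p y py = countIn-pos p (allFin n) (∈-allFin y) py

count-zero : {n : ℕ} (p : Fin n → Bool) → count p ≡ 0 → ∀ y → p y ≡ false
count-zero p count≡0 y with p y in py
... | false = refl
... | true with count-pos p y py
... | 1≤count rewrite count≡0 with 1≤count
... | ()

Complementary : {n : ℕ} → (Fin n → Bool) → (Fin n → Bool) → Set
Complementary S T = ∀ u → T u ≡ not (S u)

count-split : {n : ℕ} (S T p : Fin n → Bool) → Complementary S T →
  count (λ u → S u ∧ p u) + count (λ u → T u ∧ p u) ≡ count p
count-split S T p T≡¬S = count-additive _ _ _ pointwise
  where
  pointwise : ∀ u → ind (S u ∧ p u) + ind (T u ∧ p u) ≡ ind (p u)
  pointwise u rewrite T≡¬S u with S u | p u
  ... | true  | true  = refl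
  ... | true  | false = refl
  ... | false | true  = refl
  ... | false | false = refl

count-sizes : {n : ℕ} (S T : Fin n → Bool) → Complementary S T → count S + count T ≡ n
count-sizes {n} S T T≡¬S = begin
    count S + count T
      ≡⟨ cong₂ _+_ (count-cong _ _ (λ u → sym (∧-identityʳ (S u))))
                   (count-cong _ _ (λ u → sym (∧-identityʳ (T u)))) ⟩
    count (λ u → S u ∧ true) + count (λ u → T u ∧ true)
      ≡⟨ count-split S T (λ _ → true) T≡¬S ⟩
    count {n} (λ _ → true)
      ≡⟨ count-all n ⟩
    n ∎
  where open ≡-Reasoning

-- Balanced case.  For x ∈ S with |S| = |T| = s: g = d^G_S(x), h = d^Ḡ_S(x),
-- h' = d^Ḡ_T(x), e ≥ 0 the self-count, d = d_G(x).  Then 2g ≥ d forces h ≤ h'.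
balanced-arith : ∀ {d g h h' e s} → d ≤ 2 * g → g + h + e ≡ s → d + (h + h') + e ≡ s + s →
  h + h' ≤ 2 * h'
balanced-arith {d} {g} {h} {h'} {e} {s} d≤2g side total = begin
    h + h'  ≤⟨ +-monoˡ-≤ h' h≤h' ⟩
    h' + h' ≡⟨ double h' ⟩
    2 * h'  ∎
  where
  open ≤-Reasoning
  double : ∀ a → a + a ≡ 2 * a
  double = solve-∀
  regroupˡ : ∀ g h e → 2 * g + (h + e) + (h + e) ≡ (g + h + e) + (g + h + e)
  regroupˡ = solve-∀
  regroupʳ : ∀ g h h' e → 2 * g + (h + h') + e ≡ 2 * g + (h + e) + h'
  regroupʳ = solve-∀
  h+e≤h' : h + e ≤ h'
  h+e≤h' = +-cancelˡ-≤ (2 * g + (h + e)) (h + e) h' (begin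
    2 * g + (h + e) + (h + e)  ≡⟨ regroupˡ g h e ⟩
    (g + h + e) + (g + h + e)  ≡⟨ cong₂ _+_ side side ⟩
    s + s                      ≡⟨ total ⟨
    d + (h + h') + e           ≤⟨ +-monoˡ-≤ e (+-monoˡ-≤ (h + h') d≤2g) ⟩
    2 * g + (h + h') + e       ≡⟨ regroupʳ g h h' e ⟩
    2 * g + (h + e) + h'       ∎)
  h≤h' : h ≤ h'
  h≤h' = m+n≤o⇒m≤o h h+e≤h'

-- Unbalanced case.  For x ∈ S with 2s < n, self-count e ≥ 1 and
-- n ≤ d + 4 ≤ 2g + 4: x has no Ḡ-neighbour in S, and n ≤ 2s + 2.
sparse-arith : ∀ {n d g h e s} → 1 ≤ e → n ≤ d + 4 → d ≤ 2 * g → g + h + e ≡ s →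
  s + s < n → (h ≡ 0) × (n ≤ 2 * s + 2)
sparse-arith {n} {d} {g} {h} {e} {s} 1≤e n≤d+4 d≤2g side 2s<n = h≡0 , n≤2s+2
  where
  open ≤-Reasoning
  regroup : ∀ g h e → 2 * g + 2 * h + 2 * e ≡ (g + h + e) + (g + h + e)
  regroup = solve-∀
  shift : ∀ d h → d + 4 + 2 * h ≡ d + 2 * h + 2 + 2
  shift = solve-∀
  double : ∀ s → s + s + 2 ≡ 2 * s + 2
  double = solve-∀
  lower : 2 * g + 2 * h + 2 ≤ s + s
  lower = begin
    2 * g + 2 * h + 2              ≤⟨ +-monoʳ-≤ (2 * g + 2 * h) (*-monoʳ-≤ 2 1≤e) ⟩
    2 * g + 2 * h + 2 * e          ≡⟨ regroup g h e ⟩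
    (g + h + e) + (g + h + e)      ≡⟨ cong₂ _+_ side side ⟩
    s + s                          ∎
  bound : n + 2 * h ≤ s + s + 2
  bound = begin
    n + 2 * h                      ≤⟨ +-monoˡ-≤ (2 * h) (≤-trans n≤d+4 (+-monoˡ-≤ 4 d≤2g)) ⟩
    2 * g + 4 + 2 * h              ≡⟨ shift (2 * g) h ⟩
    2 * g + 2 * h + 2 + 2          ≤⟨ +-monoˡ-≤ 2 lower ⟩
    s + s + 2                      ∎
  n≤2s+2 : n ≤ 2 * s + 2
  n≤2s+2 = begin
    n          ≤⟨ m≤m+n n (2 * h) ⟩
    n + 2 * h  ≤⟨ bound ⟩
    s + s + 2  ≡⟨ double s ⟩
    2 * s + 2  ∎
  h≡0 : h ≡ 0
  h≡0 = n<1⇒n≡0 (*-cancelˡ-< 2 h 1 (+-cancelˡ-≤ (s + s) (suc (2 * h)) 2 (begin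
    s + s + suc (2 * h)  ≡⟨ rotate s h ⟩
    suc (s + s) + 2 * h  ≤⟨ +-monoˡ-≤ (2 * h) 2s<n ⟩
    n + 2 * h            ≤⟨ bound ⟩
    s + s + 2            ∎)))
    where
    rotate : ∀ s h → s + s + suc (2 * h) ≡ suc (s + s) + 2 * h
    rotate = solve-∀

module _ {n : ℕ} (G : Graph n) where

  private
    Ḡ : Graph n
    Ḡ = complement G

  -- Number of vertices equal to x (it is 1; only 1 ≤ selfCount x is needed).
  selfCount : Fin n → ℕ
  selfCount x = count (λ u → does (x ≟ u))

  selfCount-pos : (x : Fin n) → 1 ≤ selfCount x
  selfCount-pos x = count-pos _ x x≟x
    where
    x≟x : does (x ≟ x) ≡ true
    x≟x with x ≟ x
    ... | yes _  = refl
    ... | no x≢x = ⊥-elim (x≢x refl)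

  -- Every vertex u ≠ x is a neighbour of x in exactly one of G and Ḡ.
  others-split : (S : Fin n → Bool) (x : Fin n) →
    degIn G S x + degIn Ḡ S x ≡ count (λ u → S u ∧ not (does (x ≟ u)))
  others-split S x = count-additive _ _ _ pointwise
    where
    pointwise : ∀ u → ind (S u ∧ adj G x u) + ind (S u ∧ adj Ḡ x u)
                      ≡ ind (S u ∧ not (does (x ≟ u)))
    pointwise u with x ≟ u
    ... | yes refl rewrite irrefl G x with S x
    ...   | true  = refl
    ...   | false = refl
    pointwise u | no _ with S u | adj G x u
    ... | true  | true  = refl
    ... | true  | false = refl
    ... | false | _     = refl

  member-split : (S : Fin n → Bool) (x : Fin n) → S x ≡ true →
    count (λ u → S u ∧ not (does (x ≟ u))) + selfCount x ≡ count S
  member-split S x Sx = count-additive _ _ _ pointwise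
    where
    pointwise : ∀ u → ind (S u ∧ not (does (x ≟ u))) + ind (does (x ≟ u)) ≡ ind (S u)
    pointwise u with x ≟ u
    ... | yes refl rewrite Sx = refl
    ... | no _ with S u
    ...   | true  = refl
    ...   | false = refl

  neighbourhood-split : (S : Fin n → Bool) (x : Fin n) → S x ≡ true →
    degIn G S x + degIn Ḡ S x + selfCount x ≡ count S
  neighbourhood-split S x Sx =
    trans (cong (_+ selfCount x) (others-split S x)) (member-split S x Sx)

  degree-split : (x : Fin n) → deg G x + deg Ḡ x + selfCount x ≡ n
  degree-split x = trans (neighbourhood-split (λ _ → true) x refl) (count-all n)

  balanced-flip : (S T : Fin n → Bool) → Complementary S T → count S ≡ count T →
    (x : Fin n) → S x ≡ true → deg G x ≤ 2 * degIn G S x → deg Ḡ x ≤ 2 * degIn Ḡ T x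
  balanced-flip S T T≡¬S |S|≡|T| x Sx internal =
    subst (_≤ 2 * degIn Ḡ T x) Ḡ-split
      (balanced-arith {h = degIn Ḡ S x} {h' = degIn Ḡ T x} internal
        (neighbourhood-split S x Sx) total)
    where
    Ḡ-split : degIn Ḡ S x + degIn Ḡ T x ≡ deg Ḡ x
    Ḡ-split = count-split S T (adj Ḡ x) T≡¬S
    total : deg G x + (degIn Ḡ S x + degIn Ḡ T x) + selfCount x ≡ count S + count S
    total = begin
      deg G x + (degIn Ḡ S x + degIn Ḡ T x) + selfCount x
        ≡⟨ cong (λ d → deg G x + d + selfCount x) Ḡ-split ⟩
      deg G x + deg Ḡ x + selfCount x  ≡⟨ degree-split x ⟩
      n                                ≡⟨ count-sizes S T T≡¬S ⟨
      count S + count T                ≡⟨ cong (count S +_) |S|≡|T| ⟨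
      count S + count S                ∎
      where open ≡-Reasoning

  sparse-side : Regular G (n ∸ 4) → (S T : Fin n → Bool) → Complementary S T →
    count S < count T → (x : Fin n) → S x ≡ true → deg G x ≤ 2 * degIn G S x →
    (degIn Ḡ S x ≡ 0) × (n ≤ 2 * count S + 2)
  sparse-side regular S T T≡¬S |S|<|T| x Sx internal =
    sparse-arith {h = degIn Ḡ S x} (selfCount-pos x) n≤d+4 internal
      (neighbourhood-split S x Sx) 2|S|<n
    where
    n≤d+4 : n ≤ deg G x + 4
    n≤d+4 = subst (λ d → n ≤ d + 4) (sym (regular x))
              (subst (n ≤_) (+-comm 4 (n ∸ 4)) (m≤n+m∸n n 4))
    2|S|<n : count S + count S < n
    2|S|<n = ≤-trans (+-monoʳ-< (count S) |S|<|T|) (≤-reflexive (count-sizes S T T≡¬S))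

  sparse-side-independent : Regular G (n ∸ 4) → (S T : Fin n → Bool) → Complementary S T →
    count S < count T → (∀ x → S x ≡ true → deg G x ≤ 2 * degIn G S x) →
    ∃ (λ x → S x ≡ true) → IsIndependent Ḡ S × 2 * count S + 2 ≥ n
  sparse-side-independent regular S T T≡¬S |S|<|T| internal (x₀ , Sx₀) =
    independent , proj₂ (local x₀ Sx₀)
    where
    local : ∀ x → S x ≡ true → (degIn Ḡ S x ≡ 0) × (n ≤ 2 * count S + 2)
    local x Sx = sparse-side regular S T T≡¬S |S|<|T| x Sx (internal x Sx)
    independent : IsIndependent Ḡ S
    independent x y Sx Sy = subst (λ b → b ∧ adj Ḡ x y ≡ false) Sy
      (count-zero (λ u → S u ∧ adj Ḡ x u) (proj₁ (local x Sx)) y)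

proposition4 : (n : ℕ) (G : Graph n) → Regular G (n ∸ 4) →
    HasInternalPartition G →
    HasExternalBisection (complement G) ⊎
      ∃ (λ (S : Fin n → Bool) → IsIndependent (complement G) S × 2 * count S + 2 ≥ n)
proposition4 n G regular (A , nontrivial@((a , Aa) , (b , Ab)) , internalA , internalB) =
  by-sizes (<-cmp (count A) (count B))
  where
  B : Fin n → Bool
  B u = not (A u)
  A≡¬B : Complementary B A
  A≡¬B u = sym (not-involutive (A u))
  internalB′ : ∀ x → B x ≡ true → deg G x ≤ 2 * degIn G B x
  internalB′ x Bx = internalB x (not-injective {y = false} Bx)
  by-sizes : Tri (count A < count B) (count A ≡ count B) (count A > count B) →
    HasExternalBisection (complement G) ⊎
      ∃ (λ (S : Fin n → Bool) → IsIndependent (complement G) S × 2 * count S + 2 ≥ n)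
  by-sizes (tri< |A|<|B| _ _) =
    inj₂ (A , sparse-side-independent G regular A B (λ _ → refl) |A|<|B| internalA (a , Aa))
  by-sizes (tri> _ _ |B|<|A|) =
    inj₂ (B , sparse-side-independent G regular B A A≡¬B |B|<|A| internalB′ (b , cong not Ab))
  by-sizes (tri≈ _ |A|≡|B| _) = inj₁ (A , (nontrivial , externalA , externalB) , |A|≡|B|)
    where
    externalA : ∀ x → A x ≡ true → deg (complement G) x ≤ 2 * degIn (complement G) B x
    externalA x Ax = balanced-flip G A B (λ _ → refl) |A|≡|B| x Ax (internalA x Ax)
    externalB : ∀ x → A x ≡ false → deg (complement G) x ≤ 2 * degIn (complement G) A x
    externalB x Ax = balanced-flip G B A A≡¬B (sym |A|≡|B|) x (cong not Ax) (internalB x Ax)
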